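{- Let $H$ be a graph with $o(H)=\mathcal{S}$ and let $G$ be a connected graph with $n(G)\geq 2$. Then $\gamma_{\mathrm{SMB}}(G\odot H)=\gamma_{\mathrm{SMB}}'(G\odot H)=1+\gamma_{\mathrm{SMB}}(H)$.
   Context: All graphs are finite and simple; $n(G)$ denotes the order of $G$. The Maker-Breaker domination game on a graph $G$: Dominator and Staller alternately select a not yet selected vertex of $G$. Dominator wins if his selected vertices contain a dominating set of $G$; Staller wins if she selects at least one vertex from every dominating set of $G$. In the D-game Dominator moves first, in the S-game Staller moves first. $\gamma_{\mathrm{SMB}}(G)$ (resp. $\gamma_{\mathrm{SMB}}'(G)$) is the minimum number of moves Staller needs to win the D-game (resp. S-game) on $G$ when both players play optimally, and is $\infty$ if Staller has no winning strategy. The outcome $o(G)=\mathcal{S}$ means Staller has a winning strategy in both the D-game and the S-game. The corona $G\odot H$ is obtained from one copy of $G$ and $n(G)$ disjoint copies of $H$ by joining the $i$-th vertex of $G$ to every vertex of the $i$-th copy of $H$. -}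

module Defs where

open import Data.Nat using (ℕ; zero; suc; _+_; _*_; _<_)
open import Data.Fin using (Fin; splitAt; remQuot; _≟_)
open import Data.Fin.Subset using (Subset; _∈_)
open import Data.Bool using (Bool; true; false; _∧_; if_then_else_)
open import Data.Sum using (_⊎_; inj₁; inj₂)
open import Data.Product using (∃; _×_; _,_)
open import Relation.Binary.PropositionalEquality using (_≡_)
open import Relation.Nullary using (¬_)
open import Relation.Nullary.Decidable using (⌊_⌋)

record Graph : Set where
  constructor mkGraph
  field
    n   : ℕ
    adj : Fin n → Fin n → Bool
open Graph public

IsSimple : Graph → Set
IsSimple G = (∀ u v → adj G u v ≡ adj G v u) × (∀ v → adj G v v ≡ false)

data Reach (G : Graph) : Fin (n G) → Fin (n G) → Set where
  here : ∀ {v} → Reach G v v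
  step : ∀ {u w v} → adj G u w ≡ true → Reach G w v → Reach G u v

Connected : Graph → Set
Connected G = ∀ u v → Reach G u v

Dominating : (G : Graph) → Subset (n G) → Set
Dominating G D = ∀ v → v ∈ D ⊎ ∃ λ u → u ∈ D × adj G u v ≡ true

-- Corona G ⊙ H: vertices Fin nG ⊎ (Fin nG × Fin nH), encoded in Fin (nG + nG * nH);
-- (i , h) is vertex h of the i-th copy of H.
corona : Graph → Graph → Graph
corona G H = mkGraph (n G + n G * n H) a
  where
  a : Fin (n G + n G * n H) → Fin (n G + n G * n H) → Bool
  a x y with splitAt (n G) x | splitAt (n G) y
  ... | inj₁ i | inj₁ j = adj G i j
  ... | inj₁ i | inj₂ c with remQuot {n G} (n H) c
  ...   | (j , _) = ⌊ i ≟ j ⌋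
  a x y | inj₂ c | inj₁ j with remQuot {n G} (n H) c
  ...   | (i , _) = ⌊ i ≟ j ⌋
  a x y | inj₂ c | inj₂ d with remQuot {n G} (n H) c | remQuot {n G} (n H) d
  ...   | (i , h) | (j , h') = ⌊ i ≟ j ⌋ ∧ adj H h h'

data Owner : Set where
  free dom stal : Owner

data Player : Set where
  Dominator Staller : Player

Position : Graph → Set
Position G = Fin (n G) → Owner

emptyPos : (G : Graph) → Position G
emptyPos G _ = free

claim : (G : Graph) → Position G → Fin (n G) → Owner → Position G
claim G p v o u = if ⌊ u ≟ v ⌋ then o else p u

DomWon : (G : Graph) → Position G → Set
DomWon G p = ∃ λ D → Dominating G D × (∀ v → v ∈ D → p v ≡ dom)

StalWon : (G : Graph) → Position G → Set
StalWon G p = ∀ D → Dominating G D → ∃ λ v → v ∈ D × p v ≡ stal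

-- SWins G k t p : from position p with player t to move, Staller can force a
-- win making at most k further moves (against every Dominator strategy).
data SWins (G : Graph) : ℕ → Player → Position G → Set where
  won   : ∀ {k t p} → StalWon G p → SWins G k t p
  smove : ∀ {k p} v → ¬ DomWon G p → p v ≡ free →
          SWins G k Dominator (claim G p v stal) → SWins G (suc k) Staller p
  dmove : ∀ {k p} → ¬ DomWon G p →
          (∀ v → p v ≡ free → SWins G k Staller (claim G p v dom)) →
          SWins G k Dominator p

IsγSMB : Graph → ℕ → Set
IsγSMB G k = SWins G k Dominator (emptyPos G)
           × (∀ j → j < k → ¬ SWins G j Dominator (emptyPos G))

IsγSMB' : Graph → ℕ → Set
IsγSMB' G k = SWins G k Staller (emptyPos G)
            × (∀ j → j < k → ¬ SWins G j Staller (emptyPos G))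

OutcomeS : Graph → Set
OutcomeS G = (∃ λ k → SWins G k Dominator (emptyPos G))
           × (∃ λ k → SWins G k Staller (emptyPos G))

{-# OPTIONS --safe #-}
-- Upper bound: Staller claims a vertex u of G whose copy of H is untouched (after Dominator's
-- first move one exists, as n(G) ≥ 2) and then follows her optimal D-game strategy for H inside
-- that copy. Since u is hers, the copy can only be dominated from within it, and Dominator's moves
-- elsewhere are passes, which never hurt Staller.
--
-- Lower bound: Dominator always answers in the copy (with its vertex of G) where Staller has just
-- moved. Staller's move in a copy whose G-vertex is free is answered by taking that vertex; once
-- Staller owns the G-vertex u of a copy, that copy contains no Staller vertex yet and Dominator
-- plays his H-strategy there. Staller wins only by winning some copy together with its G-vertex,
-- which costs her one move on u and at least γ_SMB(H) moves inside the copy.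
module Submission where

open import Defs
open import Data.Bool using (true; _∧_)
open import Data.Bool.Properties using (T-≡) renaming (_≟_ to _≟ᵇ_)
open import Data.Fin using (Fin; zero; suc; _≟_; fromℕ<; punchIn; _↑ˡ_; _↑ʳ_; splitAt; join; combine; remQuot)
open import Data.Fin.Properties
  using (punchInᵢ≢i; any?; all?; ∀-cons; splitAt-↑ˡ; splitAt-↑ʳ; join-splitAt; remQuot-combine; combine-remQuot;
         combine-injectiveʳ; ↑ʳ-injective)
open import Data.Fin.Subset using (Subset; _∈_; _∉_; _⊆_) renaming (⊥ to ∅)
open import Data.Fin.Subset.Properties using (_∈?_)
open import Data.Nat using (ℕ; zero; suc; _≤_; _<_; s≤s; _*_)
open import Data.Nat.Properties using (≤-trans; n≤1+n; ≤-pred)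
open import Data.Product using (∃; _×_; _,_; proj₁; proj₂)
open import Data.Sum using (_⊎_; inj₁; inj₂; [_,_]′)
open import Data.Vec using (tabulate)
open import Data.Vec.Properties using (lookup∘tabulate; lookup⇒[]=; []=⇒lookup)
open import Function using (_∘_; id; flip)
open import Relation.Binary.PropositionalEquality using (_≡_; _≢_; refl; sym; trans; cong; cong₂; subst)
open import Relation.Nullary using (¬_; Dec; yes; no; does; contradiction; ¬?)
open import Relation.Nullary.Decidable
  using (⌊_⌋; dec-true; decidable-stable; toWitness; fromWitness; _×-dec_; _⊎-dec_)
open import Relation.Unary using (Decidable)
open import Function.Bundles using (Equivalence)

¬¬-pull-Fin : ∀ {m} {P : Fin m → Set} → (∀ i → ¬ ¬ P i) → ¬ ¬ (∀ i → P i)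
¬¬-pull-Fin {zero}  _   k = k λ ()
¬¬-pull-Fin {suc m} ¬¬P k = ¬¬P zero λ p₀ → ¬¬-pull-Fin (¬¬P ∘ suc) λ pₛ → k (∀-cons p₀ pₛ)

select : ∀ {m} {P : Fin m → Set} → Decidable P → Subset m
select P? = tabulate (does ∘ P?)

module _ {m} {P : Fin m → Set} (P? : Decidable P) where

  ∈-select⁺ : ∀ {x} → P x → x ∈ select P?
  ∈-select⁺ {x} px = lookup⇒[]= x _ (trans (lookup∘tabulate (does ∘ P?) x) (dec-true (P? x) px))

  ∈-select⁻ : ∀ {x} → x ∈ select P? → P x
  ∈-select⁻ {x} x∈ with P? x | trans (sym (lookup∘tabulate (does ∘ P?) x)) ([]=⇒lookup x∈)
  ... | yes px | _ = px

_≟ₒ_ : (o o′ : Owner) → Dec (o ≡ o′)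
free ≟ₒ free = yes refl
dom  ≟ₒ dom  = yes refl
stal ≟ₒ stal = yes refl
free ≟ₒ dom  = no λ ()
free ≟ₒ stal = no λ ()
dom  ≟ₒ free = no λ ()
dom  ≟ₒ stal = no λ ()
stal ≟ₒ free = no λ ()
stal ≟ₒ dom  = no λ ()

nonStal : ∀ {m} → (Fin m → Owner) → Subset m
nonStal p = select (λ v → ¬? (p v ≟ₒ stal))

_⊑_ : ∀ {m} → (Fin m → Owner) → (Fin m → Owner) → Set
p ⊑ p′ = ∀ v → (p′ v ≡ dom → p v ≡ dom) × (p v ≡ stal → p′ v ≡ stal)

⊑-trans : ∀ {m} {p q r : Fin m → Owner} → p ⊑ q → q ⊑ r → p ⊑ r
⊑-trans p⊑q q⊑r v = proj₁ (p⊑q v) ∘ proj₁ (q⊑r v) , proj₂ (q⊑r v) ∘ proj₂ (p⊑q v)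

≗⇒⊑ : ∀ {m} {p q : Fin m → Owner} → (∀ v → p v ≡ q v) → p ⊑ q
≗⇒⊑ p≗q v = trans (p≗q v) , trans (sym (p≗q v))

module _ (G : Graph) where

  dominating? : Decidable (Dominating G)
  dominating? D = all? λ v → (v ∈? D) ⊎-dec any? λ u → (u ∈? D) ×-dec (adj G u v ≟ᵇ true)

  Dominating-⊆ : ∀ {D E} → D ⊆ E → Dominating G D → Dominating G E
  Dominating-⊆ D⊆E domD v with domD v
  ... | inj₁ v∈D = inj₁ (D⊆E v∈D)
  ... | inj₂ (u , u∈D , uv) = inj₂ (u , D⊆E u∈D , uv)

  claim-self : ∀ (p : Position G) v o → claim G p v o v ≡ o
  claim-self p v o with v ≟ v
  ... | yes _   = refl
  ... | no v≢v = contradiction refl v≢v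

  claim-other : ∀ (p : Position G) {v} o {u} → u ≢ v → claim G p v o u ≡ p u
  claim-other p {v} o {u} u≢v with u ≟ v
  ... | yes u≡v = contradiction u≡v u≢v
  ... | no _    = refl

  claim-keeps-dom : ∀ {p : Position G} {v u} o → p v ≡ free → p u ≡ dom → claim G p v o u ≡ dom
  claim-keeps-dom {v = v} {u} o pv pu with u ≟ v
  ... | yes refl = contradiction (trans (sym pv) pu) λ ()
  ... | no _     = pu

  claim-keeps-stal : ∀ {p : Position G} {v u} o → p v ≡ free → p u ≡ stal → claim G p v o u ≡ stal
  claim-keeps-stal {v = v} {u} o pv pu with u ≟ v
  ... | yes refl = contradiction (trans (sym pv) pu) λ ()
  ... | no _     = pu

  claim-mono : ∀ {p p′ : Position G} v o → p ⊑ p′ → claim G p v o ⊑ claim G p′ v o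
  claim-mono v o p⊑p′ u with u ≟ v
  ... | yes _ = id , id
  ... | no _  = p⊑p′ u

  claim-dom-⊑ : ∀ {p : Position G} v → claim G p v dom ⊑ p
  claim-dom-⊑ v u with u ≟ v
  ... | yes _ = (λ _ → refl) , λ ()
  ... | no _  = id , id

  ⊑-claim-stal : ∀ {p : Position G} v → p ⊑ claim G p v stal
  ⊑-claim-stal v u with u ≟ v
  ... | yes _ = (λ ()) , (λ _ → refl)
  ... | no _  = id , id

  claim-stal-⊑ : ∀ {p p′ : Position G} v → p′ v ≡ stal → p ⊑ p′ → claim G p v stal ⊑ p′
  claim-stal-⊑ v p′v p⊑p′ u with u ≟ v
  ... | yes refl = trans (sym p′v) , (λ _ → p′v)
  ... | no _     = p⊑p′ u

  ⊑-claim-dom : ∀ {p p′ : Position G} v → p v ≡ dom → p ⊑ p′ → p ⊑ claim G p′ v dom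
  ⊑-claim-dom v pv p⊑p′ u with u ≟ v
  ... | yes refl = (λ _ → pv) , trans (sym pv)
  ... | no _     = p⊑p′ u

  ⊑-emptyPos : ∀ {p : Position G} → (∀ v → p v ≢ stal) → p ⊑ emptyPos G
  ⊑-emptyPos no-stal v = (λ ()) , λ pv → contradiction pv (no-stal v)

  DomWon-anti : ∀ {p p′ : Position G} → p ⊑ p′ → DomWon G p′ → DomWon G p
  DomWon-anti p⊑p′ (D , domD , D-dom) = D , domD , λ v v∈D → proj₁ (p⊑p′ v) (D-dom v v∈D)

  DomWon-mono : ∀ {p p′ : Position G} → (∀ v → p v ≡ dom → p′ v ≡ dom) → DomWon G p → DomWon G p′
  DomWon-mono p⊆p′ (D , domD , D-dom) = D , domD , λ v v∈D → p⊆p′ v (D-dom v v∈D)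

  Dominating-member : ∀ {D} → Dominating G D → Fin (n G) → ∃ λ u → u ∈ D
  Dominating-member domD v with domD v
  ... | inj₁ v∈D           = v , v∈D
  ... | inj₂ (u , u∈D , _) = u , u∈D

  ¬DomWon-empty : Fin (n G) → ¬ DomWon G (emptyPos G)
  ¬DomWon-empty v (D , domD , D-dom) with domD v
  ... | inj₁ v∈D           = contradiction (D-dom v v∈D) λ ()
  ... | inj₂ (u , u∈D , _) = contradiction (D-dom u u∈D) λ ()

  StalWon-mono : ∀ {p p′ : Position G} → p ⊑ p′ → StalWon G p → StalWon G p′
  StalWon-mono p⊑p′ sw D domD with sw D domD
  ... | v , v∈D , pv = v , v∈D , proj₂ (p⊑p′ v) pv

  StalWon-claim-dom : ∀ {p : Position G} {v} → p v ≡ free → StalWon G p → StalWon G (claim G p v dom)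
  StalWon-claim-dom {p} pv sw D domD with sw D domD
  ... | u , u∈D , pu = u , u∈D , claim-keeps-stal {p} dom pv pu

  StalWon⇒¬Dominating-nonStal : ∀ {p : Position G} → StalWon G p → ¬ Dominating G (nonStal p)
  StalWon⇒¬Dominating-nonStal {p} sw domD with sw (nonStal p) domD
  ... | v , v∈ , pv = ∈-select⁻ (λ u → ¬? (p u ≟ₒ stal)) v∈ pv

  ¬Dominating-nonStal⇒StalWon : ∀ {p : Position G} → ¬ Dominating G (nonStal p) → StalWon G p
  ¬Dominating-nonStal⇒StalWon {p} ¬domS D domD with any? (λ v → (v ∈? D) ×-dec (p v ≟ₒ stal))
  ... | yes found = found
  ... | no none   = contradiction (Dominating-⊆ D⊆nonStal domD) ¬domS
    where
    D⊆nonStal : D ⊆ nonStal p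
    D⊆nonStal {v} v∈D = ∈-select⁺ (λ u → ¬? (p u ≟ₒ stal)) λ pv → none (v , v∈D , pv)

  ¬StalWon⇒Dominating-nonStal : ∀ {p : Position G} → ¬ StalWon G p → Dominating G (nonStal p)
  ¬StalWon⇒Dominating-nonStal ¬sw = decidable-stable (dominating? _) (¬sw ∘ ¬Dominating-nonStal⇒StalWon)

  free-or-StalWon : ∀ {p : Position G} → ¬ DomWon G p → (∃ λ v → p v ≡ free) ⊎ StalWon G p
  free-or-StalWon {p} ¬dw with any? (λ v → p v ≟ₒ free)
  ... | yes found = inj₁ found
  ... | no none   = inj₂ (¬Dominating-nonStal⇒StalWon λ domS → ¬dw (nonStal p , domS , nonStal-dom))
    where
    nonStal-dom : ∀ v → v ∈ nonStal p → p v ≡ dom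
    nonStal-dom v v∈ with p v in pv
    ... | free = contradiction (v , pv) none
    ... | dom  = refl
    ... | stal = contradiction pv (∈-select⁻ (λ u → ¬? (p u ≟ₒ stal)) v∈)

  SWins⇒¬DomWon : ∀ {k t p} → SWins G k t p → ¬ DomWon G p
  SWins⇒¬DomWon (won sw) (D , domD , D-dom) with sw D domD
  ... | v , v∈D , pv = contradiction (trans (sym pv) (D-dom v v∈D)) λ ()
  SWins⇒¬DomWon (smove _ ¬dw _ _) = ¬dw
  SWins⇒¬DomWon (dmove ¬dw _)     = ¬dw

  staller-plays : ∀ {k p} v → p v ≡ free → SWins G k Dominator (claim G p v stal) → SWins G (suc k) Staller p
  staller-plays {p = p} v pv s =
    smove v (SWins⇒¬DomWon s ∘ DomWon-mono (λ _ → claim-keeps-dom {p} stal pv)) pv s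

  SWins-suc : ∀ {k t p} → SWins G k t p → SWins G (suc k) t p
  SWins-suc (won sw)          = won sw
  SWins-suc (smove v ¬dw pv s) = smove v ¬dw pv (SWins-suc s)
  SWins-suc (dmove ¬dw next)  = dmove ¬dw λ v pv → SWins-suc (next v pv)

  -- A move onto a vertex already owned in p′ is replaced by a move onto an arbitrary free vertex.
  SWins-mono : ∀ {k t p p′} → SWins G k t p → p ⊑ p′ → SWins G k t p′
  SWins-mono (won sw) p⊑p′ = won (StalWon-mono p⊑p′ sw)
  SWins-mono {p′ = p′} (smove v ¬dw pv s) p⊑p′ with p′ v in p′v
  ... | free = smove v (¬dw ∘ DomWon-anti p⊑p′) p′v (SWins-mono s (claim-mono v stal p⊑p′))
  ... | dom  = contradiction (trans (sym pv) (proj₁ (p⊑p′ v) p′v)) λ ()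
  ... | stal with free-or-StalWon (¬dw ∘ DomWon-anti p⊑p′)
  ...   | inj₁ (w , p′w) =
    staller-plays w p′w (SWins-mono s (⊑-trans (claim-stal-⊑ v p′v p⊑p′) (⊑-claim-stal w)))
  ...   | inj₂ sw        = won sw
  SWins-mono {k} {p = p} {p′} (dmove ¬dw next) p⊑p′ = dmove (¬dw ∘ DomWon-anti p⊑p′) reply
    where
    reply : ∀ v → p′ v ≡ free → SWins G k Staller (claim G p′ v dom)
    reply v p′v with p v in pv
    ... | free = SWins-mono (next v pv) (claim-mono v dom p⊑p′)
    ... | stal = contradiction (trans (sym (proj₂ (p⊑p′ v) pv)) p′v) λ ()
    ... | dom with free-or-StalWon ¬dw
    ...   | inj₁ (u , pu) = SWins-mono (next u pu) (⊑-trans (claim-dom-⊑ u) (⊑-claim-dom v pv p⊑p′))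
    ...   | inj₂ sw       = won (StalWon-mono (⊑-claim-dom v pv p⊑p′) sw)

¬DomWon⇒vertex : ∀ (G : Graph) {p : Position G} → ¬ DomWon G p → Fin (n G)
¬DomWon⇒vertex (mkGraph zero _)    ¬dw = contradiction (∅ , (λ ()) , λ _ ()) ¬dw
¬DomWon⇒vertex (mkGraph (suc _) _) _   = zero

∃≢ : ∀ {m} → 2 ≤ m → (i : Fin m) → ∃ λ j → j ≢ i
∃≢ (s≤s (s≤s _)) i = punchIn i zero , punchInᵢ≢i i zero

∀-insert : ∀ {m} {A : Fin m → Set} i → A i → (∀ l → l ≢ i → A l) → ∀ l → A l
∀-insert i Ai A-elsewhere l with l ≟ i
... | yes refl = Ai
... | no l≢i   = A-elsewhere l l≢i

⌊≟⌋⇒≡ : ∀ {m} {i j : Fin m} → ⌊ i ≟ j ⌋ ≡ true → i ≡ j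
⌊≟⌋⇒≡ = toWitness ∘ Equivalence.from T-≡

⌊≟⌋-refl : ∀ {m} (i : Fin m) → ⌊ i ≟ i ⌋ ≡ true
⌊≟⌋-refl i = Equivalence.to T-≡ (fromWitness refl)

∧-true⁻ : ∀ {a b} → a ∧ b ≡ true → a ≡ true × b ≡ true
∧-true⁻ {true} {true} refl = refl , refl

module Corona (G H : Graph) where

  C : Graph
  C = corona G H

  base : Fin (n G) → Fin (n C)
  base i = i ↑ˡ (n G * n H)

  copy : Fin (n G) → Fin (n H) → Fin (n C)
  copy i h = n G ↑ʳ combine i h

  data View : Fin (n C) → Set where
    base-view : ∀ i → View (base i)
    copy-view : ∀ i h → View (copy i h)

  view : ∀ x → View x
  view x = subst View (join-splitAt (n G) (n G * n H) x) (view-join (splitAt (n G) x))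
    where
    view-join : ∀ s → View (join (n G) (n G * n H) s)
    view-join (inj₁ i) = base-view i
    view-join (inj₂ c) = subst View (cong (n G ↑ʳ_) (combine-remQuot {n G} (n H) c)) (copy-view _ _)

  locus : Fin (n C) → Fin (n G)
  locus x = [ id , proj₁ ∘ remQuot (n H) ]′ (splitAt (n G) x)

  locus-base : ∀ i → locus (base i) ≡ i
  locus-base i rewrite splitAt-↑ˡ (n G) i (n G * n H) = refl

  locus-copy : ∀ i h → locus (copy i h) ≡ i
  locus-copy i h rewrite splitAt-↑ʳ (n G) (n G * n H) (combine i h) = cong proj₁ (remQuot-combine i h)

  base≢ : ∀ {l x} → l ≢ locus x → base l ≢ x
  base≢ {l} l≢ refl = l≢ (sym (locus-base l))

  copy≢ : ∀ {l h x} → l ≢ locus x → copy l h ≢ x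
  copy≢ {l} {h} l≢ refl = l≢ (sym (locus-copy l h))

  base≢copy : ∀ {i j h} → base i ≢ copy j h
  base≢copy {i} {j} {h} e
    with () ← trans (sym (splitAt-↑ˡ (n G) i (n G * n H)))
                    (trans (cong (splitAt (n G)) e) (splitAt-↑ʳ (n G) (n G * n H) (combine j h)))

  copy-injectiveʳ : ∀ {i h h′} → copy i h ≡ copy i h′ → h ≡ h′
  copy-injectiveʳ {i} {h} {h′} e = combine-injectiveʳ i h i h′ (↑ʳ-injective (n G) _ _ e)

  adj-base-copy : ∀ i j h → adj C (base i) (copy j h) ≡ ⌊ i ≟ j ⌋
  adj-base-copy i j h rewrite splitAt-↑ˡ (n G) i (n G * n H) | splitAt-↑ʳ (n G) (n G * n H) (combine j h)
    = cong (λ r → ⌊ i ≟ proj₁ r ⌋) (remQuot-combine j h)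

  adj-copy-base : ∀ i h j → adj C (copy i h) (base j) ≡ ⌊ i ≟ j ⌋
  adj-copy-base i h j rewrite splitAt-↑ˡ (n G) j (n G * n H) | splitAt-↑ʳ (n G) (n G * n H) (combine i h)
    = cong (λ r → ⌊ proj₁ r ≟ j ⌋) (remQuot-combine i h)

  adj-copy-copy : ∀ i h j h′ → adj C (copy i h) (copy j h′) ≡ ⌊ i ≟ j ⌋ ∧ adj H h h′
  adj-copy-copy i h j h′
    rewrite splitAt-↑ʳ (n G) (n G * n H) (combine i h) | splitAt-↑ʳ (n G) (n G * n H) (combine j h′)
    = cong₂ (λ r s → ⌊ proj₁ r ≟ proj₁ s ⌋ ∧ adj H (proj₂ r) (proj₂ s))
            (remQuot-combine i h) (remQuot-combine j h′)

  restrict : Position C → Fin (n G) → Position H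
  restrict P i h = P (copy i h)

  restrictSet : Subset (n C) → Fin (n G) → Subset (n H)
  restrictSet D i = select (λ h → copy i h ∈? D)

  restrict-dominating : ∀ {D i} → Dominating C D → base i ∉ D → Dominating H (restrictSet D i)
  restrict-dominating {D} {i} domD i∉D h with domD (copy i h)
  ... | inj₁ ih∈D = inj₁ (∈-select⁺ (λ h → copy i h ∈? D) ih∈D)
  ... | inj₂ (u , u∈D , adj-u) = dominator (view u) u∈D adj-u
    where
    dominator : ∀ {u} → View u → u ∈ D → adj C u (copy i h) ≡ true →
                h ∈ restrictSet D i ⊎ ∃ λ h′ → h′ ∈ restrictSet D i × adj H h′ h ≡ true
    dominator (base-view j) u∈D adj-u
      with refl ← ⌊≟⌋⇒≡ {i = j} {i} (trans (sym (adj-base-copy j i h)) adj-u) = contradiction u∈D i∉D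
    dominator (copy-view j h′) u∈D adj-u with ∧-true⁻ (trans (sym (adj-copy-copy j h′ i h)) adj-u)
    ... | j≡i , adj-h′ with refl ← ⌊≟⌋⇒≡ {i = j} {i} j≡i =
      inj₂ (h′ , ∈-select⁺ (λ h → copy i h ∈? D) u∈D , adj-h′)

  claim-restrict : ∀ (P : Position C) i v o h → claim C P (copy i v) o (copy i h) ≡ claim H (restrict P i) v o h
  claim-restrict P i v o h with copy i h ≟ copy i v | h ≟ v
  ... | yes _ | yes _   = refl
  ... | no _  | no _    = refl
  ... | yes e | no h≢v  = contradiction (copy-injectiveʳ e) h≢v
  ... | no ne | yes refl = contradiction refl ne

  StalWon-lift : ∀ {P i} → P (base i) ≡ stal → StalWon H (restrict P i) → StalWon C P
  StalWon-lift {P} {i} Pi sw D domD with base i ∈? D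
  ... | yes i∈D = base i , i∈D , Pi
  ... | no i∉D with sw (restrictSet D i) (restrict-dominating domD i∉D)
  ...   | h , h∈ , Ph = copy i h , ∈-select⁻ (λ h → copy i h ∈? D) h∈ , Ph

  ¬DomWon-lift : ∀ {P i} → P (base i) ≡ stal → ¬ DomWon H (restrict P i) → ¬ DomWon C P
  ¬DomWon-lift {P} {i} Pi ¬dw (D , domD , D-dom) =
    ¬dw (restrictSet D i , restrict-dominating domD i∉D ,
         λ h h∈ → D-dom _ (∈-select⁻ (λ h → copy i h ∈? D) h∈))
    where
    i∉D : base i ∉ D
    i∉D i∈D = contradiction (trans (sym Pi) (D-dom _ i∈D)) λ ()

  restrict-dominator-move : ∀ {q P} i x → View x → P x ≡ free → q ⊑ restrict P i →
                   (∃ λ h → q h ≡ free × claim H q h dom ⊑ restrict (claim C P x dom) i)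
                   ⊎ q ⊑ restrict (claim C P x dom) i
  restrict-dominator-move {P = P} i _ (base-view j) _ q⊑ =
    inj₂ (⊑-trans q⊑ (≗⇒⊑ λ h → sym (claim-other C P dom (base≢copy ∘ sym))))
  restrict-dominator-move {q} {P} i _ (copy-view j h) Px q⊑ with i ≟ j
  ... | no i≢j =
    inj₂ (⊑-trans q⊑ (≗⇒⊑ λ h′ → sym (claim-other C P dom (copy≢ (i≢j ∘ flip trans (locus-copy j h))))))
  ... | yes refl with q h in qh
  ...   | free = inj₁ (h , qh , ⊑-trans (claim-mono H h dom q⊑) (≗⇒⊑ (sym ∘ claim-restrict P i h dom)))
  ...   | dom  = inj₂ (⊑-trans (⊑-claim-dom H h qh q⊑) (≗⇒⊑ (sym ∘ claim-restrict P i h dom)))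
  ...   | stal = contradiction (trans (sym (proj₂ (q⊑ h) qh)) Px) λ ()

  lift : ∀ {k t q P} i → SWins H k t q → P (base i) ≡ stal → q ⊑ restrict P i → SWins C k t P
  lift i (won sw) Pi q⊑ = won (StalWon-lift Pi (StalWon-mono H q⊑ sw))
  lift {P = P} i (smove v ¬dw qv s) Pi q⊑ with P (copy i v) in Pv
  ... | free = staller-plays C (copy i v) Pv
                 (lift i s (claim-keeps-stal C {P} stal Pv Pi)
                    (⊑-trans (claim-mono H v stal q⊑) (≗⇒⊑ (sym ∘ claim-restrict P i v stal))))
  ... | dom  = contradiction (trans (sym qv) (proj₁ (q⊑ v) Pv)) λ ()
  ... | stal with free-or-StalWon C (¬DomWon-lift Pi (¬dw ∘ DomWon-anti H q⊑))
  ...   | inj₁ (w , Pw) = staller-plays C w Pw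
                            (lift i s (claim-keeps-stal C {P} stal Pw Pi)
                               (⊑-trans (claim-stal-⊑ H v Pv q⊑) (λ h → ⊑-claim-stal C {P} w (copy i h))))
  ...   | inj₂ sw        = won sw
  lift {k} {q = q} {P} i (dmove ¬dw next) Pi q⊑ = dmove (¬DomWon-lift Pi (¬dw ∘ DomWon-anti H q⊑)) reply
    where
    reply : ∀ x → P x ≡ free → SWins C k Staller (claim C P x dom)
    reply x Px with restrict-dominator-move i x (view x) Px q⊑
    ... | inj₁ (h , qh , q⊑′) = lift i (next h qh) (claim-keeps-stal C {P} dom Px Pi) q⊑′
    ... | inj₂ q⊑′ with free-or-StalWon H ¬dw
    ...   | inj₁ (u , qu) =
      lift i (next u qu) (claim-keeps-stal C {P} dom Px Pi) (⊑-trans (claim-dom-⊑ H u) q⊑′)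
    ...   | inj₂ sw       = won (StalWon-lift (claim-keeps-stal C {P} dom Px Pi) (StalWon-mono H q⊑′ sw))

  open-copy : ∀ {k P} → SWins H k Dominator (emptyPos H) →
              ∀ i → P (base i) ≡ free → (∀ h → P (copy i h) ≡ free) → SWins C (suc k) Staller P
  open-copy {P = P} sk i Pi fresh =
    staller-plays C (base i) Pi
      (lift i sk (claim-self C P (base i) stal)
         (≗⇒⊑ λ h → sym (trans (claim-other C P stal (base≢copy ∘ sym)) (fresh h))))

  SWins-S-upper : ∀ {k} → SWins H k Dominator (emptyPos H) → 2 ≤ n G → SWins C (suc k) Staller (emptyPos C)
  SWins-S-upper sk 2≤ = open-copy sk (fromℕ< 2≤) refl λ _ → refl

  SWins-D-upper : ∀ {k} → SWins H k Dominator (emptyPos H) → 2 ≤ n G → SWins C (suc k) Dominator (emptyPos C)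
  SWins-D-upper {k} sk 2≤ = dmove (¬DomWon-empty C (base (fromℕ< 2≤))) reply
    where
    reply : ∀ x → emptyPos C x ≡ free → SWins C (suc k) Staller (claim C (emptyPos C) x dom)
    reply x _ with i , i≢ ← ∃≢ 2≤ (locus x) =
      open-copy sk i (claim-other C _ dom (base≢ i≢)) λ _ → claim-other C _ dom (copy≢ i≢)

  Unwon : Position C → Fin (n G) → Set
  Unwon P l = P (base l) ≢ stal ⊎ ¬ StalWon H (restrict P l)

  ¬StalWon-corona : Fin (n H) → ∀ {P} → (∀ l → Unwon P l) → ¬ StalWon C P
  ¬StalWon-corona h₀ {P} unwon sw = StalWon⇒¬Dominating-nonStal C sw (dominated ∘ view)
    where
    copy∈ : ∀ {l h} → h ∈ nonStal (restrict P l) → copy l h ∈ nonStal P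
    copy∈ {l} h∈ =
      ∈-select⁺ (λ v → ¬? (P v ≟ₒ stal)) (∈-select⁻ (λ v → ¬? (restrict P l v ≟ₒ stal)) h∈)
    base∈ : ∀ {l} → P (base l) ≢ stal → base l ∈ nonStal P
    base∈ = ∈-select⁺ (λ v → ¬? (P v ≟ₒ stal))
    dominated : ∀ {x} → View x → x ∈ nonStal P ⊎ ∃ λ u → u ∈ nonStal P × adj C u x ≡ true
    dominated (base-view l) with unwon l
    ... | inj₁ Pl  = inj₁ (base∈ Pl)
    ... | inj₂ ¬sw with u , u∈ ← Dominating-member H (¬StalWon⇒Dominating-nonStal H ¬sw) h₀ =
      inj₂ (copy l u , copy∈ u∈ , trans (adj-copy-base l u l) (⌊≟⌋-refl l))
    dominated (copy-view l h) with unwon l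
    ... | inj₁ Pl  = inj₂ (base l , base∈ Pl , trans (adj-base-copy l l h) (⌊≟⌋-refl l))
    ... | inj₂ ¬sw with ¬StalWon⇒Dominating-nonStal H ¬sw h
    ...   | inj₁ h∈ = inj₁ (copy∈ h∈)
    ...   | inj₂ (u , u∈ , adj-uh) =
      inj₂ (copy l u , copy∈ u∈ , trans (adj-copy-copy l u l h) (cong₂ _∧_ (⌊≟⌋-refl l) adj-uh))

  -- Dominator's invariant on the l-th copy while Staller has at most b moves left.
  data Guarded (b : ℕ) (P : Position C) (l : Fin (n G)) : Set where
    base-dom  : P (base l) ≡ dom → Guarded b P l
    base-free : P (base l) ≡ free → (∀ h → P (copy l h) ≢ stal) → Guarded b P l
    base-stal : P (base l) ≡ stal → ¬ SWins H b Staller (restrict P l) → Guarded b P l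

  Guarded⇒Unwon : ∀ {b P l} → Guarded b P l → Unwon P l
  Guarded⇒Unwon (base-dom Pl)    = inj₁ λ Pl′ → contradiction (trans (sym Pl) Pl′) λ ()
  Guarded⇒Unwon (base-free Pl _) = inj₁ λ Pl′ → contradiction (trans (sym Pl) Pl′) λ ()
  Guarded⇒Unwon (base-stal _ ¬s) = inj₂ (¬s ∘ won)

  Guarded-pred : ∀ {b P l} → Guarded (suc b) P l → Guarded b P l
  Guarded-pred (base-dom Pl)          = base-dom Pl
  Guarded-pred (base-free Pl no-stal) = base-free Pl no-stal
  Guarded-pred (base-stal Pl ¬s)      = base-stal Pl (¬s ∘ SWins-suc H)

  Guarded-claim-dom : ∀ {b P l} y → Guarded b P l → Guarded b (claim C P y dom) l
  Guarded-claim-dom {P = P} {l} y g with base l ≟ y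
  ... | yes refl = base-dom (claim-self C P (base l) dom)
  ... | no l≢y with g
  ...   | base-dom Pl          = base-dom (trans (claim-other C P dom l≢y) Pl)
  ...   | base-free Pl no-stal = base-free (trans (claim-other C P dom l≢y) Pl)
                                   λ h → no-stal h ∘ proj₂ (claim-dom-⊑ C {P} y (copy l h))
  ...   | base-stal Pl ¬s      = base-stal (trans (claim-other C P dom l≢y) Pl)
                                   λ s → ¬s (SWins-mono H s λ h → claim-dom-⊑ C {P} y (copy l h))

  Guarded-elsewhere : ∀ {b P l x} o → l ≢ locus x → Guarded b P l → Guarded b (claim C P x o) l
  Guarded-elsewhere {P = P} o l≢ (base-dom Pl) = base-dom (trans (claim-other C P o (base≢ l≢)) Pl)
  Guarded-elsewhere {P = P} o l≢ (base-free Pl no-stal) =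
    base-free (trans (claim-other C P o (base≢ l≢)) Pl)
      λ h → no-stal h ∘ trans (sym (claim-other C P o (copy≢ l≢)))
  Guarded-elsewhere {P = P} o l≢ (base-stal Pl ¬s) =
    base-stal (trans (claim-other C P o (base≢ l≢)) Pl)
      λ s → ¬s (SWins-mono H s (≗⇒⊑ λ h → claim-other C P o (copy≢ l≢)))

module Lower (G H : Graph) (k : ℕ) (below-k : ∀ j → j < k → ¬ SWins H j Dominator (emptyPos H))
             (h₀ : Fin (n H)) where

  open Corona G H

  AllGuarded : ℕ → Position C → Set
  AllGuarded b P = ∀ l → Guarded b P l

  NoStallerWin : ℕ → Set
  NoStallerWin b = ∀ {P} → AllGuarded b P → ¬ SWins C b Staller P

  ¬StalWon-guarded : ∀ {b P} → AllGuarded b P → ¬ StalWon C P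
  ¬StalWon-guarded g = ¬StalWon-corona h₀ (Guarded⇒Unwon ∘ g)

  reply-anywhere : ∀ {b P} → NoStallerWin b → AllGuarded b P → ¬ SWins C b Dominator P
  reply-anywhere _ g (won sw) = ¬StalWon-guarded g sw
  reply-anywhere ih g (dmove ¬dw next) with free-or-StalWon C ¬dw
  ... | inj₁ (y , Py) = ih (λ l → Guarded-claim-dom y (g l)) (next y Py)
  ... | inj₂ sw       = ¬StalWon-guarded g sw

  reply-with : ∀ {b P} y → P y ≡ free → NoStallerWin b → AllGuarded b (claim C P y dom) →
               ¬ SWins C b Dominator P
  reply-with y Py _  g (won sw)        = ¬StalWon-guarded g (StalWon-claim-dom C Py sw)
  reply-with y Py ih g (dmove _ next) = ih g (next y Py)

  reply-in-copy : ∀ {b P} i → NoStallerWin b → P (base i) ≡ stal → ¬ SWins H b Dominator (restrict P i) →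
                  (∀ l → l ≢ i → Guarded b P l) → ¬ SWins C b Dominator P
  reply-in-copy i _ _ ¬sH others (won sw) =
    ¬StalWon-corona h₀ (∀-insert i (inj₂ (¬sH ∘ won)) λ l l≢i → Guarded⇒Unwon (others l l≢i)) sw
  reply-in-copy {b} {P} i ih Pi ¬sH others (dmove ¬dw next) = ¬¬-pull-Fin answer (¬sH ∘ dmove ¬dwH)
    where
    ¬dwH : ¬ DomWon H (restrict P i)
    ¬dwH dwH =
      reply-anywhere ih (∀-insert i (base-stal Pi λ s → SWins⇒¬DomWon H s dwH) others) (dmove ¬dw next)
    answer : ∀ h → ¬ ¬ (restrict P i h ≡ free → SWins H b Staller (claim H (restrict P i) h dom))
    answer h ¬answer with P (copy i h) ≟ₒ free
    ... | no Ph  = ¬answer λ Ph′ → contradiction Ph′ Ph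
    ... | yes Ph = ih guarded (next (copy i h) Ph)
      where
      guarded : AllGuarded b (claim C P (copy i h) dom)
      guarded = ∀-insert i
        (base-stal (claim-keeps-stal C {P} dom Ph Pi)
           λ s → ¬answer λ _ → SWins-mono H s (≗⇒⊑ (claim-restrict P i h dom)))
        (λ l l≢i → Guarded-claim-dom (copy i h) (others l l≢i))

  lower : ∀ {b P} → b ≤ k → AllGuarded b P → ¬ SWins C b Staller P
  lower _ g (won sw) = ¬StalWon-guarded g sw
  lower {suc b} {P} b<k g (smove x _ Px s) = staller-move x (view x) Px s
    where
    ih : NoStallerWin b
    ih = lower {b} (≤-trans (n≤1+n b) b<k)
    untouched : ∀ {x i} → locus x ≡ i → ∀ l → l ≢ i → Guarded b (claim C P x stal) l
    untouched refl l l≢ = Guarded-elsewhere stal l≢ (Guarded-pred (g l))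
    staller-move : ∀ x → View x → P x ≡ free → ¬ SWins C b Dominator (claim C P x stal)
    staller-move _ (base-view i) Pi with g i
    ... | base-dom Pi′    = contradiction (trans (sym Pi) Pi′) λ ()
    ... | base-stal Pi′ _ = contradiction (trans (sym Pi) Pi′) λ ()
    ... | base-free _ no-stal = reply-in-copy i ih (claim-self C P (base i) stal) ¬sH (untouched (locus-base i))
      where
      ¬sH : ¬ SWins H b Dominator (restrict (claim C P (base i) stal) i)
      ¬sH sH = below-k b b<k (SWins-mono H sH (⊑-emptyPos H no-stal′))
        where
        no-stal′ : ∀ h → restrict (claim C P (base i) stal) i h ≢ stal
        no-stal′ h = no-stal h ∘ trans (sym (claim-other C P stal (base≢copy ∘ sym)))
    staller-move _ (copy-view i h) Ph with g i
    ... | base-dom Pi = reply-anywhere ih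
                          (∀-insert i (base-dom (trans (claim-other C P stal base≢copy) Pi)) (untouched (locus-copy i h)))
    ... | base-free Pi _ = reply-with (base i) (trans (claim-other C P stal base≢copy) Pi) ih
                             (∀-insert i (base-dom (claim-self C (claim C P (copy i h) stal) (base i) dom))
                                λ l l≢i → Guarded-claim-dom (base i) (untouched (locus-copy i h) l l≢i))
    ... | base-stal Pi ¬sS =
      reply-in-copy i ih (trans (claim-other C P stal base≢copy) Pi) ¬sH (untouched (locus-copy i h))
      where
      ¬sH : ¬ SWins H b Dominator (restrict (claim C P (copy i h) stal) i)
      ¬sH sH = ¬sS (staller-plays H h Ph (SWins-mono H sH (≗⇒⊑ (claim-restrict P i h stal))))

  fresh : ∀ {b} → AllGuarded b (emptyPos C)
  fresh _ = base-free refl λ _ ()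

  SWins-S-lower : ∀ {j} → j ≤ k → ¬ SWins C j Staller (emptyPos C)
  SWins-S-lower j≤k = lower j≤k fresh

  SWins-D-lower : ∀ {j} → j ≤ k → ¬ SWins C j Dominator (emptyPos C)
  SWins-D-lower j≤k = reply-anywhere (lower j≤k) fresh

theorem3p1 : (G H : Graph) → IsSimple G → IsSimple H → OutcomeS H →
             Connected G → 2 ≤ n G →
             (k : ℕ) → IsγSMB H k →
             IsγSMB (corona G H) (suc k) × IsγSMB' (corona G H) (suc k)
theorem3p1 G H _ _ _ _ 2≤n k (sk , below-k) =
  (SWins-D-upper sk 2≤n , λ j j<1+k → SWins-D-lower (≤-pred j<1+k)) ,
  (SWins-S-upper sk 2≤n , λ j j<1+k → SWins-S-lower (≤-pred j<1+k))
  where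
  open Corona G H
  open Lower G H k below-k (¬DomWon⇒vertex H (SWins⇒¬DomWon H sk))
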